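{- Let $G$ be an embedded graph, fix an all-crossing direction of its medial graph $G_m$, and let $D\subseteq E(G)$ be the set of $d$-edges of $G$ with respect to this direction. Then $G-D$ and $G^{*}-D^{c}$ are both Eulerian.
   Context: View $G$ as a ribbon graph (vertex discs and edge discs, each edge meeting vertices at its two ends). The medial graph $G_m$ is drawn inside $G$: it has one vertex $v_e$ on each edge $e$ (a 4-valent crossing whose four incident arcs leave towards the four corners of $e$: the two sides at each of the two ends of $e$), and for each pair of consecutive half-edges around a vertex of $G$ an edge of $G_m$ joining the corresponding corners, running along the vertex boundary; an isolated vertex contributes a free loop. An all-crossing direction of $G_m$ is an orientation of its edges such that at each vertex $v_e$, going around its four incident edges in cyclic order, one meets head, head, tail, tail. Then the two incoming edges at $v_e$ are adjacent in the cyclic order: either they come from the two corners at the same end of $e$ ($v_e$ is then a $c$-vertex and $e$ a $c$-edge), or they come from corners at the two different ends of $e$ on the same side of $e$ ($v_e$ is a $d$-vertex and $e$ a $d$-edge). $G^*$ is the geometric dual with $E(G^*)$ identified with $E(G)$, $D^c=E(G)\setminus D$, and Eulerian means all vertex degrees even. -}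

module Defs where

open import Data.Nat using (ℕ; zero; suc; _+_)
open import Data.Nat.Divisibility using (_∣_)
open import Data.Bool using (Bool; true; false; not; _∧_; _∨_; if_then_else_)
open import Data.Fin using (Fin)
open import Data.Fin.Properties using (_≟_)
open import Data.List using (List; allFin; map)
open import Data.Nat.ListAction using (sum)
open import Data.Product using (_×_; _,_; proj₁; proj₂)
open import Relation.Nullary using (¬_)
open import Relation.Nullary.Decidable using (⌊_⌋)
open import Relation.Binary.PropositionalEquality using (_≡_; _≢_)

-- Ribbon graphs via flags (graph-encoded maps).
-- An edge e of G (edge disc) has four corners / flags (e , end , side):
--   end  : which end of e (false / true),
--   side : which side of e (false / true).
-- τ₀ swaps the end (same side), τ₂ swaps the side (same end); these are
-- fixed by the edge structure.  τ₁ pairs each corner with the corner of the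
-- consecutive half-edge around the same vertex (the corner on the same
-- vertex-boundary arc).  Medial edges of G_m are exactly the pairs {f , τ₁ f}.

Flag : ℕ → Set
Flag n = Fin n × Bool × Bool

edgeOf : ∀ {n} → Flag n → Fin n
edgeOf f = proj₁ f

endOf : ∀ {n} → Flag n → Bool
endOf f = proj₁ (proj₂ f)

sideOf : ∀ {n} → Flag n → Bool
sideOf f = proj₂ (proj₂ f)

τ₀ : ∀ {n} → Flag n → Flag n
τ₀ (e , a , s) = (e , not a , s)

τ₂ : ∀ {n} → Flag n → Flag n
τ₂ (e , a , s) = (e , a , not s)

data Conn {A : Set} (σ ρ : A → A) : A → A → Set where
  here  : ∀ {x} → Conn σ ρ x x
  stepσ : ∀ {x y} → Conn σ ρ (σ x) y → Conn σ ρ x y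
  stepρ : ∀ {x y} → Conn σ ρ (ρ x) y → Conn σ ρ x y

-- An embedded (ribbon) graph, possibly non-orientable, possibly disconnected.
-- Vertices Fin nV (vertices with no incident edge are isolated vertices),
-- edges Fin nE, and a labelling of the faces (boundary components) by Fin nF.
record EmbeddedGraph : Set where
  field
    nV nE nF : ℕ
    ends     : Fin nE → Bool → Fin nV
    τ₁       : Flag nE → Flag nE
    τ₁-invol : ∀ f → τ₁ (τ₁ f) ≡ f
    τ₁-fpf   : ∀ f → τ₁ f ≢ f
    τ₁-vert  : ∀ f → ends (edgeOf (τ₁ f)) (endOf (τ₁ f)) ≡ ends (edgeOf f) (endOf f)
    -- the corners at a vertex form a single cyclic rotation (one τ₁,τ₂-orbit)
    vert-conn : ∀ f g → ends (edgeOf f) (endOf f) ≡ ends (edgeOf g) (endOf g)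
                → Conn τ₁ τ₂ f g
    face      : Flag nE → Fin nF
    face-τ₀   : ∀ f → face (τ₀ f) ≡ face f
    face-τ₁   : ∀ f → face (τ₁ f) ≡ face f
    face-conn : ∀ f g → face f ≡ face g → Conn τ₀ τ₁ f g

  vertexOf : Flag nE → Fin nV
  vertexOf f = ends (edgeOf f) (endOf f)

open EmbeddedGraph public

-- A direction is given by h : Flag → Bool, where h f = true means that the
-- medial edge {f , τ₁ f} has its head at the corner f (i.e. enters v_e there).

IsDirection : (G : EmbeddedGraph) → (Flag (nE G) → Bool) → Set
IsDirection G h = ∀ f → h (τ₁ G f) ≡ not (h f)

data HHTT : Bool → Bool → Bool → Bool → Set where
  r0 : HHTT true  true  false false
  r1 : HHTT false true  true  false
  r2 : HHTT false false true  true
  r3 : HHTT true  false false true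

-- Cyclic order of the four corners around v_e :
-- (end0,side0), (end1,side0), (end1,side1), (end0,side1).
IsAllCrossing : (G : EmbeddedGraph) → (Flag (nE G) → Bool) → Set
IsAllCrossing G h =
  IsDirection G h ×
  (∀ e → HHTT (h (e , false , false)) (h (e , true , false))
              (h (e , true , true))   (h (e , false , true)))

-- e is a d-edge: both incoming medial edges at v_e come from the two
-- different ends of e on the same side of e.
isD : (G : EmbeddedGraph) → (Flag (nE G) → Bool) → Fin (nE G) → Bool
isD G h e = (h (e , false , false) ∧ h (e , true , false))
          ∨ (h (e , false , true)  ∧ h (e , true , true))

Even : ℕ → Set
Even n = 2 ∣ n

ind : Bool → ℕ
ind b = if b then 1 else 0

-- degree of vertex v in the spanning subgraph of G with edge set
-- {e | keep e = true} (loops count twice: one per end)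
degSub : (G : EmbeddedGraph) → (Fin (nE G) → Bool) → Fin (nV G) → ℕ
degSub G keep v =
  sum (map (λ e → ind (keep e ∧ ⌊ ends G e false ≟ v ⌋)
                + ind (keep e ∧ ⌊ ends G e true  ≟ v ⌋)) (allFin (nE G)))

-- degree of vertex φ (a face of G) in the spanning subgraph of the dual G*
-- with edge set {e | keep e = true}; the dual edge e* joins the faces on the
-- two sides of e.
degDualSub : (G : EmbeddedGraph) → (Fin (nE G) → Bool) → Fin (nF G) → ℕ
degDualSub G keep φ =
  sum (map (λ e → ind (keep e ∧ ⌊ face G (e , false , false) ≟ φ ⌋)
                + ind (keep e ∧ ⌊ face G (e , false , true)  ≟ φ ⌋)) (allFin (nE G)))

-- G - D : keep the edges not in D ;  G* - D^c : keep the edges in D.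
EulerianMinus : (G : EmbeddedGraph) → (Fin (nE G) → Bool) → Set
EulerianMinus G D = ∀ v → Even (degSub G (λ e → not (D e)) v)

EulerianDualMinusCompl : (G : EmbeddedGraph) → (Fin (nE G) → Bool) → Set
EulerianDualMinusCompl G D = ∀ φ → Even (degDualSub G D φ)

{-# OPTIONS --safe #-}
-- Each medial edge {f , τ₁ f} has exactly one head, and its two corners lie at
-- the same vertex and in the same face of G.  So a vertex or face of degree k
-- carries exactly k heads among its 2k corners.  At a c-edge each end carries
-- zero or two heads and each side exactly one; at a d-edge each end carries
-- exactly one and each side zero or two.  Counting heads mod 2 at a vertex v
-- gives deg v ≡ #(ends of d-edges at v), i.e. v has even degree in G - D;
-- at a face φ it gives deg φ ≡ #(sides of c-edges on φ), i.e. φ has even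
-- degree in G* - Dᶜ.
module Submission where

open import Defs
open import Data.Bool using (Bool; true; false; not; _∧_; _∨_)
open import Data.Fin using (Fin)
open import Data.Fin.Properties using (_≟_)
open import Data.List using (List; []; _∷_; _++_; map; allFin; cartesianProduct)
open import Data.List.Properties using (map-++; map-∘; map-cong)
open import Data.List.Membership.Propositional using (_∈_)
open import Data.List.Membership.Propositional.Properties
  using (∈-map⁺; ∈-allFin; ∈-cartesianProduct⁺)
open import Data.List.Membership.Propositional.Properties.WithK using (unique∧set⇒bag)
open import Data.List.Relation.Binary.BagAndSetEquality using (∼bag⇒↭)
import Data.List.Relation.Binary.Permutation.Propositional.Properties as Perm
open import Data.List.Relation.Unary.All using ([]; _∷_)
open import Data.List.Relation.Unary.AllPairs using ([]; _∷_)
open import Data.List.Relation.Unary.Any using (here; there)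
open import Data.List.Relation.Unary.Unique.Propositional using (Unique)
import Data.List.Relation.Unary.Unique.Propositional.Properties as Unique
open import Data.Nat using (ℕ; _+_; _*_)
open import Data.Nat.Divisibility using (_∣?_; divides; _∣0; ∣m∣n⇒∣m+n; ∣m+n∣m⇒∣n)
open import Data.Nat.ListAction using (sum)
open import Data.Nat.ListAction.Properties using (sum-++; sum-↭)
open import Data.Nat.Properties
  using (+-assoc; +-comm; +-identityʳ; *-comm; *-cancelˡ-≡; +-commutativeSemigroup)
open import Algebra.Properties.CommutativeSemigroup +-commutativeSemigroup using (interchange)
open import Data.Product using (_×_; _,_)
open import Function using (_∘_)
open import Function.Bundles using (mk⇔)
open import Relation.Binary.PropositionalEquality
  using (_≡_; refl; sym; trans; cong; cong₂; subst; module ≡-Reasoning)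
open import Relation.Nullary.Decidable using (⌊_⌋; True; toWitness)

private
  variable
    A B : Set

sum-map-+ : (f g : A → ℕ) (xs : List A) →
            sum (map (λ x → f x + g x) xs) ≡ sum (map f xs) + sum (map g xs)
sum-map-+ f g []       = refl
sum-map-+ f g (x ∷ xs) = trans (cong (f x + g x +_) (sum-map-+ f g xs)) (interchange (f x) (g x) _ _)

sum-map-even : (f : A → ℕ) (xs : List A) → (∀ x → Even (f x)) → Even (sum (map f xs))
sum-map-even f []       even-f = 2 ∣0
sum-map-even f (x ∷ xs) even-f = ∣m∣n⇒∣m+n (even-f x) (sum-map-even f xs even-f)

sum-map-cartesianProduct : (g : A × B → ℕ) (xs : List A) (ys : List B) →
  sum (map g (cartesianProduct xs ys)) ≡ sum (map (λ x → sum (map (λ y → g (x , y)) ys)) xs)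
sum-map-cartesianProduct g []       ys = refl
sum-map-cartesianProduct g (x ∷ xs) ys = begin
  sum (map g (map (x ,_) ys ++ cartesianProduct xs ys))
    ≡⟨ cong sum (map-++ g (map (x ,_) ys) _) ⟩
  sum (map g (map (x ,_) ys) ++ map g (cartesianProduct xs ys))
    ≡⟨ sum-++ (map g (map (x ,_) ys)) _ ⟩
  sum (map g (map (x ,_) ys)) + sum (map g (cartesianProduct xs ys))
    ≡⟨ cong₂ _+_ (cong sum (sym (map-∘ ys))) (sum-map-cartesianProduct g xs ys) ⟩
  sum (map (λ y → g (x , y)) ys) + sum (map (λ x → sum (map (λ y → g (x , y)) ys)) xs) ∎
  where open ≡-Reasoning

sum-map-involution : {xs : List A} → Unique xs → (∀ x → x ∈ xs) →
                     (σ : A → A) → (∀ x → σ (σ x) ≡ x) →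
                     (g : A → ℕ) → sum (map (g ∘ σ) xs) ≡ sum (map g xs)
sum-map-involution {xs = xs} unique complete σ σ-involutive g =
  trans (cong sum (map-∘ xs)) (sum-↭ (Perm.map⁺ g σxs↭xs))
  where
  σ-injective : ∀ {x y} → σ x ≡ σ y → x ≡ y
  σ-injective {x} {y} eq = trans (sym (σ-involutive x)) (trans (cong σ eq) (σ-involutive y))
  σ-surjective : ∀ x → x ∈ map σ xs
  σ-surjective x = subst (_∈ map σ xs) (σ-involutive x) (∈-map⁺ σ (complete (σ x)))
  σxs↭xs = ∼bag⇒↭ (unique∧set⇒bag (Unique.map⁺ σ-injective unique) unique
                                  (mk⇔ (λ _ → complete _) (λ _ → σ-surjective _)))

even-double : ∀ m → Even (m + m)
even-double m = divides m (trans (cong (m +_) (sym (+-identityʳ m))) (*-comm 2 m))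

double-injective : ∀ {m n} → m + m ≡ n + n → m ≡ n
double-injective {m} {n} eq = *-cancelˡ-≡ m n 2 (begin
  2 * m   ≡⟨ cong (m +_) (+-identityʳ m) ⟩
  m + m   ≡⟨ eq ⟩
  n + n   ≡⟨ cong (n +_) (+-identityʳ n) ⟨
  2 * n   ∎)
  where open ≡-Reasoning

even-sum-of-parity-defects : (H C M : A → ℕ) (xs : List A) →
  sum (map H xs) ≡ sum (map M xs) → (∀ x → Even (H x + C x + M x)) → Even (sum (map C xs))
even-sum-of-parity-defects H C M xs ΣH≡ΣM even-HCM =
  ∣m+n∣m⇒∣n (subst Even rearrange even-ΣHCM) (even-double ΣM)
  where
  ΣC = sum (map C xs)
  ΣM = sum (map M xs)
  even-ΣHCM : Even (sum (map H xs) + ΣC + ΣM)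
  even-ΣHCM = subst Even
    (trans (sum-map-+ (λ x → H x + C x) M xs) (cong (_+ ΣM) (sum-map-+ H C xs)))
    (sum-map-even _ xs even-HCM)
  rearrange : sum (map H xs) + ΣC + ΣM ≡ ΣM + ΣM + ΣC
  rearrange = begin
    sum (map H xs) + ΣC + ΣM  ≡⟨ cong (λ t → t + ΣC + ΣM) ΣH≡ΣM ⟩
    ΣM + ΣC + ΣM              ≡⟨ +-assoc ΣM ΣC ΣM ⟩
    ΣM + (ΣC + ΣM)            ≡⟨ cong (ΣM +_) (+-comm ΣC ΣM) ⟩
    ΣM + (ΣM + ΣC)            ≡⟨ +-assoc ΣM ΣM ΣC ⟨
    ΣM + ΣM + ΣC              ∎
    where open ≡-Reasoning

bools : List Bool
bools = false ∷ true ∷ []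

flags : ∀ n → List (Flag n)
flags n = cartesianProduct (allFin n) (cartesianProduct bools bools)

∈-bools : ∀ b → b ∈ bools
∈-bools false = here refl
∈-bools true  = there (here refl)

∈-flags : ∀ {n} (f : Flag n) → f ∈ flags n
∈-flags (e , a , s) = ∈-cartesianProduct⁺ (∈-allFin e) (∈-cartesianProduct⁺ (∈-bools a) (∈-bools s))

flags-unique : ∀ n → Unique (flags n)
flags-unique n = Unique.cartesianProduct⁺ (Unique.allFin⁺ n)
                   (Unique.cartesianProduct⁺ bools-unique bools-unique)
  where
  bools-unique : Unique bools
  bools-unique = ((λ ()) ∷ []) ∷ [] ∷ []

cornerSum : ∀ {n} → (Flag n → ℕ) → Fin n → ℕ
cornerSum g e = g (e , false , false) + (g (e , false , true) + (g (e , true , false) + g (e , true , true)))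

sum-flags : ∀ n (g : Flag n → ℕ) → sum (map g (flags n)) ≡ sum (map (cornerSum g) (allFin n))
sum-flags n g = trans (sum-map-cartesianProduct g (allFin n) _)
  (cong sum (map-cong (λ e → cong (g (e , false , false) +_) (cong (g (e , false , true) +_)
     (cong (g (e , true , false) +_) (+-identityʳ (g (e , true , true)))))) (allFin n)))

ind-∧-split : ∀ s b → ind (s ∧ b) + ind (s ∧ not b) ≡ ind s
ind-∧-split false _     = refl
ind-∧-split true  false = refl
ind-∧-split true  true  = refl

module CornerSet (G : EmbeddedGraph) {h : Flag (nE G) → Bool} (dir : IsDirection G h)
                 (S : Flag (nE G) → Bool) (S-τ₁ : ∀ f → S (τ₁ G f) ≡ S f) where

  count : (Flag (nE G) → Bool) → ℕ
  count Q = sum (map (ind ∘ Q) (flags (nE G)))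

  heads tails : ℕ
  heads = count (λ f → S f ∧ h f)
  tails = count (λ f → S f ∧ not (h f))

  heads≡tails : heads ≡ tails
  heads≡tails = begin
    heads
      ≡⟨ sum-map-involution (flags-unique _) ∈-flags (τ₁ G) (τ₁-invol G) (λ f → ind (S f ∧ h f)) ⟨
    sum (map (λ f → ind (S (τ₁ G f) ∧ h (τ₁ G f))) (flags (nE G)))
      ≡⟨ cong sum (map-cong (λ f → cong₂ (λ s b → ind (s ∧ b)) (S-τ₁ f) (dir f)) (flags (nE G))) ⟩
    tails ∎
    where open ≡-Reasoning

  heads≡half : (m : Fin (nE G) → ℕ) → (∀ e → cornerSum (ind ∘ S) e ≡ m e + m e) →
               heads ≡ sum (map m (allFin (nE G)))
  heads≡half m size = double-injective (begin
    heads + heads                 ≡⟨ cong (heads +_) heads≡tails ⟩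
    heads + tails                 ≡⟨ sum-map-+ _ _ (flags (nE G)) ⟨
    sum (map (λ f → ind (S f ∧ h f) + ind (S f ∧ not (h f))) (flags (nE G)))
      ≡⟨ cong sum (map-cong (λ f → ind-∧-split (S f) (h f)) (flags (nE G))) ⟩
    count S                       ≡⟨ sum-flags (nE G) (ind ∘ S) ⟩
    sum (map (cornerSum (ind ∘ S)) (allFin (nE G)))
      ≡⟨ cong sum (map-cong size (allFin (nE G))) ⟩
    sum (map (λ e → m e + m e) (allFin (nE G)))
      ≡⟨ sum-map-+ m m (allFin (nE G)) ⟩
    sum (map m (allFin (nE G))) + sum (map m (allFin (nE G))) ∎)
    where open ≡-Reasoning

  even-sum-of-edge-parities : (m K : Fin (nE G) → ℕ) →
    (∀ e → cornerSum (ind ∘ S) e ≡ m e + m e) →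
    (∀ e → Even (cornerSum (λ f → ind (S f ∧ h f)) e + K e + m e)) →
    Even (sum (map K (allFin (nE G))))
  even-sum-of-edge-parities m K size parity =
    even-sum-of-parity-defects _ K m (allFin (nE G))
      (trans (sym (sum-flags (nE G) (λ f → ind (S f ∧ h f)))) (heads≡half m size)) parity

decide-even : ∀ {n} {two∣n : True (2 ∣? n)} → Even n
decide-even {two∣n = two∣n} = toWitness two∣n

end-parity : ∀ {b₀₀ b₁₀ b₁₁ b₀₁} → HHTT b₀₀ b₁₀ b₁₁ b₀₁ → ∀ x₀ x₁ →
  let c = not ((b₀₀ ∧ b₁₀) ∨ (b₀₁ ∧ b₁₁)) in
  Even (ind (x₀ ∧ b₀₀) + (ind (x₀ ∧ b₀₁) + (ind (x₁ ∧ b₁₀) + ind (x₁ ∧ b₁₁)))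
        + (ind (c ∧ x₀) + ind (c ∧ x₁)) + (ind x₀ + ind x₁))
end-parity r0 false false = decide-even
end-parity r0 false true  = decide-even
end-parity r0 true  false = decide-even
end-parity r0 true  true  = decide-even
end-parity r1 false false = decide-even
end-parity r1 false true  = decide-even
end-parity r1 true  false = decide-even
end-parity r1 true  true  = decide-even
end-parity r2 false false = decide-even
end-parity r2 false true  = decide-even
end-parity r2 true  false = decide-even
end-parity r2 true  true  = decide-even
end-parity r3 false false = decide-even
end-parity r3 false true  = decide-even
end-parity r3 true  false = decide-even
end-parity r3 true  true  = decide-even

side-parity : ∀ {b₀₀ b₁₀ b₁₁ b₀₁} → HHTT b₀₀ b₁₀ b₁₁ b₀₁ → ∀ z₀ z₁ →
  let d = (b₀₀ ∧ b₁₀) ∨ (b₀₁ ∧ b₁₁) in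
  Even (ind (z₀ ∧ b₀₀) + (ind (z₁ ∧ b₀₁) + (ind (z₀ ∧ b₁₀) + ind (z₁ ∧ b₁₁)))
        + (ind (d ∧ z₀) + ind (d ∧ z₁)) + (ind z₀ + ind z₁))
side-parity r0 false false = decide-even
side-parity r0 false true  = decide-even
side-parity r0 true  false = decide-even
side-parity r0 true  true  = decide-even
side-parity r1 false false = decide-even
side-parity r1 false true  = decide-even
side-parity r1 true  false = decide-even
side-parity r1 true  true  = decide-even
side-parity r2 false false = decide-even
side-parity r2 false true  = decide-even
side-parity r2 true  false = decide-even
side-parity r2 true  true  = decide-even
side-parity r3 false false = decide-even
side-parity r3 false true  = decide-even
side-parity r3 true  false = decide-even
side-parity r3 true  true  = decide-even

face-at-end₀ : (G : EmbeddedGraph) (f : Flag (nE G)) →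
               face G (edgeOf f , false , sideOf f) ≡ face G f
face-at-end₀ G (e , false , s) = refl
face-at-end₀ G (e , true  , s) = sym (face-τ₀ G (e , false , s))

module _ (G : EmbeddedGraph) {h : Flag (nE G) → Bool} (dir : IsDirection G h)
         (hhtt : ∀ e → HHTT (h (e , false , false)) (h (e , true , false))
                            (h (e , true , true))   (h (e , false , true))) where

  G-minus-D-eulerian : EulerianMinus G (isD G h)
  G-minus-D-eulerian v =
    even-sum-of-edge-parities m _
      (λ e → let a = ind (at e false); b = ind (at e true) in
             trans (sym (+-assoc a a (b + b))) (interchange a a b b))
      (λ e → end-parity (hhtt e) (at e false) (at e true))
    where
    at : Fin (nE G) → Bool → Bool
    at e a = ⌊ ends G e a ≟ v ⌋
    m : Fin (nE G) → ℕ
    m e = ind (at e false) + ind (at e true)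
    open CornerSet G dir (λ f → ⌊ vertexOf G f ≟ v ⌋)
                   (λ f → cong (λ w → ⌊ w ≟ v ⌋) (τ₁-vert G f))

  dual-minus-Dᶜ-eulerian : EulerianDualMinusCompl G (isD G h)
  dual-minus-Dᶜ-eulerian φ =
    even-sum-of-edge-parities m _ (λ e → sym (+-assoc (ind (at e false)) (ind (at e true)) (m e)))
      (λ e → side-parity (hhtt e) (at e false) (at e true))
    where
    at : Fin (nE G) → Bool → Bool
    at e s = ⌊ face G (e , false , s) ≟ φ ⌋
    m : Fin (nE G) → ℕ
    m e = ind (at e false) + ind (at e true)
    -- read at end 0, so that membership of (e , a , s) depends definitionally on s alone
    open CornerSet G dir (λ f → at (edgeOf f) (sideOf f))
                   (λ f → cong (λ ψ → ⌊ ψ ≟ φ ⌋)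
                     (trans (face-at-end₀ G (τ₁ G f)) (trans (face-τ₁ G f) (sym (face-at-end₀ G f)))))

lemma2 : (G : EmbeddedGraph) (h : Flag (nE G) → Bool) → IsAllCrossing G h
         → EulerianMinus G (isD G h) × EulerianDualMinusCompl G (isD G h)
lemma2 G h (dir , hhtt) = G-minus-D-eulerian G dir hhtt , dual-minus-Dᶜ-eulerian G dir hhtt
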